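{- Let $G$ be a graph having $m$ vertices of degree at least $4$. If there exists a one-face embedding of $G$, then there are at least $2^m$ one-face embeddings of $G$.
   Context: A map with $e$ edges is a triple $(\alpha,\beta,\gamma)$ of permutations of $[2e]$ (half-edges), with $\alpha$ a fixed-point-free involution (edges), $\beta$ giving the cyclic order of half-edges at each vertex, and $\gamma=\alpha\beta$, whose cycles are the faces. The graph is $G=(\alpha,Par_\beta)$, where $Par_\beta$ is the partition of $[2e]$ into the cycles of $\beta$ (vertices), and $deg(\nu)=|\nu|$. An embedding of $G$ is any map $(\alpha,\beta',\alpha\beta')$ with $Par_{\beta'}=Par_\beta$ (distinct embeddings = distinct $\beta'$); it is one-face if $\alpha\beta'$ is a single cycle. -}

module Defs where

open import Data.Nat using (ℕ; zero; suc; _*_; _^_; _≤ᵇ_)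
open import Data.Fin using (Fin; toℕ; _≟_)
open import Data.Fin.Permutation using (Permutation′; _⟨$⟩ʳ_)
open import Data.Bool using (Bool; _∧_; not)
open import Data.List using (List; length; filterᵇ; upTo; allFin)
open import Data.Bool.ListAction using (any; all)
open import Data.Product using (Σ; ∃; ∃-syntax; _×_; _,_)
open import Function using (_⇔_)
open import Relation.Binary.PropositionalEquality using (_≡_; _≢_)
open import Relation.Nullary.Decidable using (⌊_⌋)

_^[_]_ : ∀ {n} → Permutation′ n → ℕ → Fin n → Fin n
π ^[ zero ] i = i
π ^[ suc k ] i = π ⟨$⟩ʳ (π ^[ k ] i)

_·_ : ∀ {n} → Permutation′ n → Permutation′ n → Fin n → Fin n
(α · β) i = α ⟨$⟩ʳ (β ⟨$⟩ʳ i)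

iter : ∀ {n} → (Fin n → Fin n) → ℕ → Fin n → Fin n
iter f zero i = i
iter f (suc k) i = f (iter f k i)

SameCycle : ∀ {n} → Permutation′ n → Fin n → Fin n → Set
SameCycle π i j = ∃[ k ] π ^[ k ] i ≡ j

FPFInvolution : ∀ {n} → Permutation′ n → Set
FPFInvolution α = ∀ i → (α ⟨$⟩ʳ (α ⟨$⟩ʳ i) ≡ i) × (α ⟨$⟩ʳ i ≢ i)

SamePartition : ∀ {n} → Permutation′ n → Permutation′ n → Set
SamePartition β β' = ∀ i j → SameCycle β i j ⇔ SameCycle β' i j

-- the map (α, β, αβ) has exactly one face: αβ is a single cycle
OneFace : ∀ {n} → Permutation′ n → Permutation′ n → Set
OneFace α β = ∀ i j → ∃[ k ] iter (α · β) k i ≡ j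

-- β' gives a one-face embedding of the graph G = (α, Par_β)
OneFaceEmbedding : ∀ {n} → Permutation′ n → Permutation′ n → Permutation′ n → Set
OneFaceEmbedding α β β' = SamePartition β β' × OneFace α β'

-- Decidable (Boolean) cycle membership: j ∈ {π^k(i) | k < n},
-- which is the whole cycle of π through i since cycles have length ≤ n.
inCycleᵇ : ∀ {n} → Permutation′ n → Fin n → Fin n → Bool
inCycleᵇ {n} π i j = any (λ k → ⌊ π ^[ k ] i ≟ j ⌋) (upTo n)

-- degree of the vertex (cycle of β) containing half-edge i
deg : ∀ {n} → Permutation′ n → Fin n → ℕ
deg {n} β i = length (filterᵇ (inCycleᵇ β i) (allFin n))

isRepᵇ : ∀ {n} → Permutation′ n → Fin n → Bool
isRepᵇ {n} β i = all (λ j → not (inCycleᵇ β i j) Data.Bool.∨ (toℕ i ≤ᵇ toℕ j)) (allFin n)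

numDegAtLeast4 : ∀ {n} → Permutation′ n → ℕ
numDegAtLeast4 {n} β =
  length (filterᵇ (λ i → isRepᵇ β i ∧ (4 ≤ᵇ deg β i)) (allFin n))

-- Let β₀ be a one-face embedding, γ₀ = α β₀ its face permutation, and
-- y₀, y₁, y₂, y₃ distinct half-edges at one vertex. They lie on one cycle of β₀
-- (the vertex) and on the single cycle of γ₀ (the face). Replacing β₀ by β₀ σ
-- for a permutation σ of these four points replaces γ₀ by γ₀ σ, and:
--   * a 3-cycle (a b c) keeps a cycle of f intact if f meets a, b, c in this
--     cyclic order (rotation-preserves);
--   * (a c)(b d) keeps a cycle of f intact if f meets a, b, c, d in the cyclic
--     order a, b, c, d or a, d, c, b (crossSwap-preserves).
-- Comparing the positions of y₁, y₂, y₃ after y₀ along both cycles, one of the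
-- two moves is compatible with both (Flip.flip). Flipping or not at each of
-- the m vertices independently gives 2^m embeddings, pairwise different since
-- the flips touch disjoint vertices (Embeddings.family).

module Submission where

open import Defs
open import Data.Nat
  using (ℕ; zero; suc; _+_; _∸_; _*_; _^_; _≤ᵇ_; _≤_; _<_; z≤n; s≤s; _%_; _/_; >-nonZero)
import Data.Nat.Properties as ℕ
open import Data.Nat.DivMod using (m≡m%n+[m/n]*n; m%n<n)
open import Data.Fin using (Fin; toℕ; _≟_; remQuot; combine)
open import Data.Fin.Patterns using (0F; 1F)
import Data.Fin.Properties as Fin
open import Data.Fin.Permutation
  using (Permutation′; _⟨$⟩ʳ_; _⟨$⟩ˡ_; inverseˡ; _∘ₚ_; transpose; _≈_)
open import Data.Bool using (Bool; true; T; _∧_; _∨_; not)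
open import Data.Bool.Properties using (T-∧)
open import Data.Product using (Σ; ∃; ∃-syntax; _×_; _,_; proj₁; proj₂; uncurry)
open import Data.Sum using (_⊎_; inj₁; inj₂)
open import Data.List using (List; []; _∷_; map; length; filterᵇ; allFin; upTo)
open import Data.List.Membership.Propositional using (_∈_; _∉_; lose)
open import Data.List.Membership.Propositional.Properties using (∈-map⁻; ∈-map⁺; ∈-upTo⁺; ∈-allFin)
open import Data.List.Relation.Unary.Any using (here; there; satisfied)
open import Data.List.Relation.Unary.Any.Properties using (any⁺; any⁻)
open import Data.List.Relation.Unary.All using (All; []; _∷_; lookup)
import Data.List.Relation.Unary.All as All
open import Data.List.Relation.Unary.All.Properties using (all⁺; all-filter)
open import Data.List.Relation.Unary.AllPairs using (AllPairs; []; _∷_)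
open import Data.List.Relation.Unary.Unique.Propositional using (Unique)
import Data.List.Relation.Unary.Unique.Propositional.Properties as UP
open import Relation.Nullary using (¬_; Dec; yes; no; contradiction)
open import Relation.Nullary.Decidable using (_×-dec_; ⌊_⌋; toWitness; fromWitness; T?)
open import Relation.Binary.Definitions using (tri<; tri≈; tri>)
open import Relation.Binary.PropositionalEquality
  using (_≡_; _≢_; refl; sym; trans; cong; subst; module ≡-Reasoning)
open import Function using (_⇔_; mk⇔; _∘_)
open import Function.Bundles using (Equivalence)
open import Function.Properties.Equivalence using () renaming (trans to ⇔-trans; sym to ⇔-sym)

open ≡-Reasoning

least : (P : ℕ → Set) → (∀ t → Dec (P t)) → ∀ {k} → P k →
        ∃[ t ] P t × (∀ s → s < t → ¬ P s)
least P P? {zero} p = 0 , p , λ _ ()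
least P P? {suc k} p with P? 0
... | yes p₀ = 0 , p₀ , λ _ ()
... | no ¬p₀ with least (P ∘ suc) (P? ∘ suc) p
...   | t , pt , below = suc t , pt , λ { zero _ → ¬p₀ ; (suc s) (s≤s s<t) → below s s<t }

module _ {n : ℕ} where

  Reach : (Fin n → Fin n) → Fin n → Fin n → Set
  Reach f x y = ∃[ k ] iter f k x ≡ y

  SameOrbits : (Fin n → Fin n) → (Fin n → Fin n) → Set
  SameOrbits f g = ∀ i j → Reach f i j ⇔ Reach g i j

  iter-+ : ∀ f k l (x : Fin n) → iter f (k + l) x ≡ iter f k (iter f l x)
  iter-+ f zero    l x = refl
  iter-+ f (suc k) l x = cong f (iter-+ f k l x)

  Reach-refl : ∀ f x → Reach f x x
  Reach-refl f x = 0 , refl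

  Reach-step : ∀ f x → Reach f x (f x)
  Reach-step f x = 1 , refl

  Reach-trans : ∀ {f x y z} → Reach f x y → Reach f y z → Reach f x z
  Reach-trans {f} {x} (k , refl) (l , refl) = l + k , iter-+ f l k x

  pow≡iter : ∀ (π : Permutation′ n) k x → π ^[ k ] x ≡ iter (π ⟨$⟩ʳ_) k x
  pow≡iter π zero    x = refl
  pow≡iter π (suc k) x = cong (π ⟨$⟩ʳ_) (pow≡iter π k x)

  SameCycle⇔Reach : ∀ π {i j} → SameCycle π i j ⇔ Reach (π ⟨$⟩ʳ_) i j
  SameCycle⇔Reach π {i} = mk⇔ (λ (k , e) → k , trans (sym (pow≡iter π k i)) e)
                              (λ (k , e) → k , trans (pow≡iter π k i) e)

module _ {n : ℕ} where

  Reach-along : ∀ {f g : Fin n → Fin n} → (∀ z → Reach f z (g z)) → ∀ {i j} → Reach g i j → Reach f i j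
  Reach-along {f} {g} step {i} (k , refl) = go k
    where
    go : ∀ k → Reach f i (iter g k i)
    go zero    = Reach-refl f i
    go (suc k) = Reach-trans (go k) (step _)

  Seg : (Fin n → Fin n) → List (Fin n) → Fin n → Fin n → Set
  Seg f T x y = ∃[ k ] iter f k x ≡ y × (∀ t → t < k → iter f t x ∉ T)

  Seg→Reach : ∀ {f T z y} → Seg f T (f z) y → Reach f z y
  Seg→Reach {f} {z = z} (k , e , _) = Reach-trans (Reach-step f z) (k , e)

  Seg-transfer : ∀ {f g T x y} → (∀ z → z ∉ T → g z ≡ f z) → Seg f T x y → Reach g x y
  Seg-transfer {f} {g} {T} {x} same (k , e , avoid) = k , trans (agree k ℕ.≤-refl) e
    where
    agree : ∀ t → t ≤ k → iter g t x ≡ iter f t x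
    agree zero    _     = refl
    agree (suc t) t<k = trans (cong g (agree t (ℕ.<⇒≤ t<k))) (same _ (avoid t t<k))

module Rewire {n : ℕ} (f : Fin n → Fin n) (σ : Permutation′ n) (T : List (Fin n))
              (fixes : ∀ z → z ∉ T → σ ⟨$⟩ʳ z ≡ z) where

  open import Data.List.Membership.DecPropositional (_≟_ {n = n}) using (_∈?_)

  g : Fin n → Fin n
  g z = f (σ ⟨$⟩ʳ z)

  hop : ∀ {z y t} → σ ⟨$⟩ʳ z ≡ y → Seg f T (f y) t → Reach g z t
  hop {z} e s = Reach-trans (subst (Reach g z) (cong f e) (Reach-step g z))
                            (Seg-transfer (λ w w∉ → cong f (fixes w w∉)) s)

  rewire : (∀ z → z ∈ T → Reach f z (σ ⟨$⟩ʳ z)) →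
           (∀ z → z ∈ T → ∃[ w ] σ ⟨$⟩ʳ w ≡ z × Reach g z w) →
           SameOrbits g f
  rewire forward backward i j = mk⇔ (Reach-along g-step) (Reach-along f-step)
    where
    g-step : ∀ z → Reach f z (g z)
    g-step z with z ∈? T
    ... | yes z∈ = Reach-trans (forward z z∈) (Reach-step f _)
    ... | no  z∉ = subst (Reach f z) (cong f (sym (fixes z z∉))) (Reach-step f z)
    f-step : ∀ z → Reach g z (f z)
    f-step z with z ∈? T
    ... | no  z∉ = subst (Reach g z) (cong f (fixes z z∉)) (Reach-step g z)
    ... | yes z∈ with backward z z∈
    ...   | w , σw≡z , z→w = Reach-trans z→w (subst (Reach g w) (cong f σw≡z) (Reach-step g w))

module _ {n : ℕ} where

  transpose-left : ∀ (i j : Fin n) → transpose i j ⟨$⟩ʳ i ≡ j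
  transpose-left i j with i ≟ i
  ... | yes _  = refl
  ... | no i≢i = contradiction refl i≢i

  transpose-right : ∀ (i j : Fin n) → transpose i j ⟨$⟩ʳ j ≡ i
  transpose-right i j with j ≟ i
  ... | yes j≡i = j≡i
  ... | no  _   with j ≟ j
  ...   | yes _  = refl
  ...   | no j≢j = contradiction refl j≢j

  transpose-other : ∀ {i j k : Fin n} → k ≢ i → k ≢ j → transpose i j ⟨$⟩ʳ k ≡ k
  transpose-other {i} {j} {k} k≢i k≢j with k ≟ i
  ... | yes k≡i = contradiction k≡i k≢i
  ... | no  _   with k ≟ j
  ...   | yes k≡j = contradiction k≡j k≢j
  ...   | no  _   = refl

  record IsRotation (σ : Permutation′ n) (a b c : Fin n) : Set where
    field
      a↦b : σ ⟨$⟩ʳ a ≡ b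
      b↦c : σ ⟨$⟩ʳ b ≡ c
      c↦a : σ ⟨$⟩ʳ c ≡ a
      fixes : ∀ z → z ∉ a ∷ b ∷ c ∷ [] → σ ⟨$⟩ʳ z ≡ z

  rotation : ∀ {a b c : Fin n} → a ≢ b → b ≢ c → a ≢ c → ∃[ σ ] IsRotation σ a b c
  rotation {a} {b} {c} a≢b b≢c a≢c = transpose b c ∘ₚ transpose a b , record
    { a↦b = trans (cong (transpose a b ⟨$⟩ʳ_) (transpose-other a≢b a≢c)) (transpose-left a b)
    ; b↦c = trans (cong (transpose a b ⟨$⟩ʳ_) (transpose-left b c))
                  (transpose-other (a≢c ∘ sym) (b≢c ∘ sym))
    ; c↦a = trans (cong (transpose a b ⟨$⟩ʳ_) (transpose-right b c)) (transpose-right a b)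
    ; fixes = λ z z∉ → trans (cong (transpose a b ⟨$⟩ʳ_)
                               (transpose-other (z∉ ∘ there ∘ here) (z∉ ∘ there ∘ there ∘ here)))
                             (transpose-other (z∉ ∘ here) (z∉ ∘ there ∘ here))
    }

  record IsCrossSwap (σ : Permutation′ n) (a b c d : Fin n) : Set where
    field
      a↦c : σ ⟨$⟩ʳ a ≡ c
      c↦a : σ ⟨$⟩ʳ c ≡ a
      b↦d : σ ⟨$⟩ʳ b ≡ d
      d↦b : σ ⟨$⟩ʳ d ≡ b
      fixes : ∀ z → z ∉ a ∷ b ∷ c ∷ d ∷ [] → σ ⟨$⟩ʳ z ≡ z

  crossSwap : ∀ {a b c d : Fin n} → a ≢ b → a ≢ c → a ≢ d → b ≢ c → b ≢ d → c ≢ d →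
              ∃[ σ ] IsCrossSwap σ a b c d
  crossSwap {a} {b} {c} {d} a≢b a≢c a≢d b≢c b≢d c≢d = transpose b d ∘ₚ transpose a c , record
    { a↦c = trans (cong (transpose a c ⟨$⟩ʳ_) (transpose-other a≢b a≢d)) (transpose-left a c)
    ; c↦a = trans (cong (transpose a c ⟨$⟩ʳ_) (transpose-other (b≢c ∘ sym) c≢d)) (transpose-right a c)
    ; b↦d = trans (cong (transpose a c ⟨$⟩ʳ_) (transpose-left b d))
                  (transpose-other (a≢d ∘ sym) (c≢d ∘ sym))
    ; d↦b = trans (cong (transpose a c ⟨$⟩ʳ_) (transpose-right b d)) (transpose-other (a≢b ∘ sym) b≢c)
    ; fixes = λ z z∉ → trans (cong (transpose a c ⟨$⟩ʳ_)
                               (transpose-other (z∉ ∘ there ∘ here) (z∉ ∘ there ∘ there ∘ there ∘ here)))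
                             (transpose-other (z∉ ∘ here) (z∉ ∘ there ∘ there ∘ here))
    }

  crossSwap-mirror : ∀ {σ} {a b c d : Fin n} → IsCrossSwap σ a b c d → IsCrossSwap σ a d c b
  crossSwap-mirror {a = a} {b} {c} {d} cs = record
    { a↦c = a↦c ; c↦a = c↦a ; b↦d = d↦b ; d↦b = b↦d
    ; fixes = λ z z∉ → fixes z (z∉ ∘ reorder)
    }
    where
    open IsCrossSwap cs
    reorder : ∀ {z} → z ∈ a ∷ b ∷ c ∷ d ∷ [] → z ∈ a ∷ d ∷ c ∷ b ∷ []
    reorder (here e)                         = here e
    reorder (there (here e))                 = there (there (there (here e)))
    reorder (there (there (here e)))         = there (there (here e))
    reorder (there (there (there (here e)))) = there (here e)

permute-injective : ∀ {n} (π : Permutation′ n) {y z} → π ⟨$⟩ʳ y ≡ π ⟨$⟩ʳ z → y ≡ z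
permute-injective π e = trans (sym (inverseˡ π)) (trans (cong (π ⟨$⟩ˡ_) e) (inverseˡ π))

module Orbit {n : ℕ} (π : Permutation′ n) (x : Fin n) where

  f : Fin n → Fin n
  f = π ⟨$⟩ʳ_

  iter-injective : ∀ k {y z} → iter f k y ≡ iter f k z → y ≡ z
  iter-injective zero    e = e
  iter-injective (suc k) e = iter-injective k (permute-injective π e)

  iter-comm : ∀ k l y → iter f k (iter f l y) ≡ iter f l (iter f k y)
  iter-comm k l y = begin
    iter f k (iter f l y) ≡⟨ iter-+ f k l y ⟨
    iter f (k + l) y      ≡⟨ cong (λ m → iter f m y) (ℕ.+-comm k l) ⟩
    iter f (l + k) y      ≡⟨ iter-+ f l k y ⟩
    iter f l (iter f k y) ∎

  -- By pigeonhole, two of x, f x, …, fⁿ x coincide; cancelling gives a return.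
  returns : ∃[ d ] (0 < d × iter f d x ≡ x) × d ≤ n
  returns with Fin.pigeonhole (ℕ.n<1+n n) (λ (i : Fin (suc n)) → iter f (toℕ i) x)
  ... | i , j , i<j , e = toℕ j ∸ toℕ i , (ℕ.m<n⇒0<n∸m i<j , back) , bound
    where
    d = toℕ j ∸ toℕ i
    bound : d ≤ n
    bound = ℕ.≤-trans (ℕ.m∸n≤m (toℕ j) (toℕ i)) (Fin.toℕ≤pred[n] j)
    back : iter f d x ≡ x
    back = iter-injective (toℕ i) (begin
      iter f (toℕ i) (iter f d x) ≡⟨ iter-comm (toℕ i) d x ⟩
      iter f d (iter f (toℕ i) x) ≡⟨ iter-+ f d (toℕ i) x ⟨
      iter f (d + toℕ i) x        ≡⟨ cong (λ m → iter f m x) (ℕ.m∸n+n≡m (ℕ.<⇒≤ i<j)) ⟩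
      iter f (toℕ j) x            ≡⟨ e ⟨
      iter f (toℕ i) x            ∎)

  private
    Return : ℕ → Set
    Return d = 0 < d × iter f d x ≡ x

  -- The period: the least positive return time. It is opaque, so that only
  -- the properties below are ever used (and it is never computed).
  opaque
    private
      first-return : ∃[ t ] Return t × (∀ s → s < t → ¬ Return s)
      first-return = least Return (λ d → (0 ℕ.<? d) ×-dec (iter f d x ≟ x)) (proj₁ (proj₂ returns))

    period : ℕ
    period = proj₁ first-return

    period-pos : 0 < period
    period-pos = proj₁ (proj₁ (proj₂ first-return))

    period-returns : iter f period x ≡ x
    period-returns = proj₂ (proj₁ (proj₂ first-return))

    period-minimal : ∀ d → d < period → 0 < d → iter f d x ≢ x
    period-minimal d d<p 0<d e = proj₂ (proj₂ first-return) d d<p (0<d , e)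

    period≤n : period ≤ n
    period≤n = ℕ.≤-trans (ℕ.≮⇒≥ (λ d<p → proj₂ (proj₂ first-return) _ d<p (proj₁ (proj₂ returns))))
                         (proj₂ (proj₂ returns))

  iter-multiple : ∀ q → iter f (q * period) x ≡ x
  iter-multiple zero    = refl
  iter-multiple (suc q) = begin
    iter f (period + q * period) x ≡⟨ iter-+ f period (q * period) x ⟩
    iter f period (iter f (q * period) x) ≡⟨ cong (iter f period) (iter-multiple q) ⟩
    iter f period x ≡⟨ period-returns ⟩
    x ∎

  position : ∀ {y} → Reach f x y → ∃[ k ] k < period × iter f k x ≡ y
  position {y} (m , e) = m % period , m%n<n m period , (begin
    iter f r x                       ≡⟨ cong (iter f r) (iter-multiple q) ⟨
    iter f r (iter f (q * period) x) ≡⟨ iter-+ f r (q * period) x ⟨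
    iter f (r + q * period) x        ≡⟨ cong (λ t → iter f t x) (m≡m%n+[m/n]*n m period) ⟨
    iter f m x                       ≡⟨ e ⟩
    y                                ∎)
    where
    instance _ = >-nonZero period-pos
    r q : ℕ
    r = m % period
    q = m / period

  no-early-return : ∀ {k l} → k < l → l < period → iter f k x ≢ iter f l x
  no-early-return {k} {l} k<l l<p e = period-minimal (l ∸ k) (ℕ.≤-<-trans (ℕ.m∸n≤m l k) l<p)
    (ℕ.m<n⇒0<n∸m k<l) (sym (iter-injective k (begin
      iter f k x                  ≡⟨ e ⟩
      iter f l x                  ≡⟨ cong (λ t → iter f t x) (ℕ.m∸n+n≡m (ℕ.<⇒≤ k<l)) ⟨
      iter f (l ∸ k + k) x        ≡⟨ iter-+ f (l ∸ k) k x ⟩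
      iter f (l ∸ k) (iter f k x) ≡⟨ iter-comm (l ∸ k) k x ⟩
      iter f k (iter f (l ∸ k) x) ∎)))

  position-unique : ∀ {k l} → k < period → l < period → iter f k x ≡ iter f l x → k ≡ l
  position-unique {k} {l} k<p l<p e with ℕ.<-cmp k l
  ... | tri≈ _ k≡l _ = k≡l
  ... | tri< k<l _ _ = contradiction e (no-early-return k<l l<p)
  ... | tri> _ _ l<k = contradiction (sym e) (no-early-return l<k k<p)

  position⁺ : ∀ {y} → y ≢ x → Reach f x y → ∃[ k ] (0 < k × k < period) × iter f k x ≡ y
  position⁺ y≢x r with position r
  ... | zero  , _   , e = contradiction (sym e) y≢x
  ... | suc k , k<p , e = suc k , (s≤s z≤n , k<p) , e

  -- Walking on from position k for period ∸ k steps closes the cycle.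
  return-path : ∀ {y} → Reach f x y → Reach f y x
  return-path r with position r
  ... | k , k<p , refl = period ∸ k , (begin
    iter f (period ∸ k) (iter f k x) ≡⟨ iter-+ f (period ∸ k) k x ⟨
    iter f (period ∸ k + k) x        ≡⟨ cong (λ t → iter f t x) (ℕ.m∸n+n≡m (ℕ.<⇒≤ k<p)) ⟩
    iter f period x                  ≡⟨ period-returns ⟩
    x                                ∎)

  marked : List ℕ → List (Fin n)
  marked qs = map (λ q → iter f q x) qs

  unmarked : ∀ qs {u v s} → All (_< period) qs → All (λ q → q ≤ u ⊎ v ≤ q) qs →
             u < s → s < v → v ≤ period → iter f s x ∉ marked qs
  unmarked qs qs<p outside u<s s<v v≤p s∈ with ∈-map⁻ _ s∈
  ... | q , q∈ , e with lookup outside q∈ | position-unique (ℕ.<-≤-trans s<v v≤p) (lookup qs<p q∈) e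
  ...   | inj₁ q≤u | refl = ℕ.<⇒≱ u<s q≤u
  ...   | inj₂ v≤q | refl = ℕ.<⇒≱ s<v v≤q

  arc : ∀ qs {u v} → All (_< period) qs → All (λ q → q ≤ u ⊎ v ≤ q) qs → u < v → v ≤ period →
        Seg f (marked qs) (f (iter f u x)) (iter f v x)
  arc qs {u} {v} qs<p outside u<v v≤p = v ∸ suc u , arrive , avoid
    where
    arrive : iter f (v ∸ suc u) (f (iter f u x)) ≡ iter f v x
    arrive = trans (sym (iter-+ f (v ∸ suc u) (suc u) x)) (cong (λ t → iter f t x) (ℕ.m∸n+n≡m u<v))
    avoid : ∀ t → t < v ∸ suc u → iter f t (f (iter f u x)) ∉ marked qs
    avoid t t<len = subst (_∉ marked qs) (iter-+ f t (suc u) x)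
      (unmarked qs qs<p outside (ℕ.m≤n+m (suc u) t)
        (subst (t + suc u <_) (ℕ.m∸n+n≡m u<v) (ℕ.+-monoˡ-< (suc u) t<len)) v≤p)

  rotation-preserves : ∀ {σ b c k l} → 0 < k → k < l → l < period →
                       iter f k x ≡ b → iter f l x ≡ c → IsRotation σ x b c →
                       SameOrbits (λ z → f (σ ⟨$⟩ʳ z)) f
  rotation-preserves {σ} {k = k} {l} 0<k k<l l<p refl refl rot = rewire forward backward
    where
    open IsRotation rot
    open Rewire f σ (marked (0 ∷ k ∷ l ∷ [])) fixes
    corners : List (Fin n)
    corners = marked (0 ∷ k ∷ l ∷ [])
    bounds : All (_< period) (0 ∷ k ∷ l ∷ [])
    bounds = period-pos ∷ ℕ.<-trans k<l l<p ∷ l<p ∷ []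
    x⇝b : Seg f corners (f x) (iter f k x)
    x⇝b = arc (0 ∷ k ∷ l ∷ []) bounds (inj₁ z≤n ∷ inj₂ ℕ.≤-refl ∷ inj₂ (ℕ.<⇒≤ k<l) ∷ [])
              0<k (ℕ.<⇒≤ (ℕ.<-trans k<l l<p))
    b⇝c : Seg f corners (f (iter f k x)) (iter f l x)
    b⇝c = arc (0 ∷ k ∷ l ∷ []) bounds (inj₁ z≤n ∷ inj₁ ℕ.≤-refl ∷ inj₂ ℕ.≤-refl ∷ [])
              k<l (ℕ.<⇒≤ l<p)
    c⇝x : Seg f corners (f (iter f l x)) x
    c⇝x = subst (Seg f corners _) period-returns
            (arc (0 ∷ k ∷ l ∷ []) bounds (inj₁ z≤n ∷ inj₁ (ℕ.<⇒≤ k<l) ∷ inj₁ ℕ.≤-refl ∷ [])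
                 l<p ℕ.≤-refl)
    forward : ∀ z → z ∈ corners → Reach f z (σ ⟨$⟩ʳ z)
    forward _ (here refl)                 = subst (Reach f x) (sym a↦b) (Seg→Reach x⇝b)
    forward _ (there (here refl))         = subst (Reach f _) (sym b↦c) (Seg→Reach b⇝c)
    forward _ (there (there (here refl))) = subst (Reach f _) (sym c↦a) (Seg→Reach c⇝x)
    backward : ∀ z → z ∈ corners → ∃[ w ] σ ⟨$⟩ʳ w ≡ z × Reach g z w
    backward _ (here refl)                 = _ , c↦a , hop a↦b b⇝c
    backward _ (there (here refl))         = _ , a↦b , hop b↦c c⇝x
    backward _ (there (there (here refl))) = _ , b↦c , hop c↦a x⇝b

  crossSwap-preserves : ∀ {σ b c d k l m} → 0 < k → k < l → l < m → m < period →
                        iter f k x ≡ b → iter f l x ≡ c → iter f m x ≡ d → IsCrossSwap σ x b c d →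
                        SameOrbits (λ z → f (σ ⟨$⟩ʳ z)) f
  crossSwap-preserves {σ} {k = k} {l} {m} 0<k k<l l<m m<p refl refl refl cs = rewire forward backward
    where
    open IsCrossSwap cs
    open Rewire f σ (marked (0 ∷ k ∷ l ∷ m ∷ [])) fixes
    corners : List (Fin n)
    corners = marked (0 ∷ k ∷ l ∷ m ∷ [])
    l<p : l < period
    l<p = ℕ.<-trans l<m m<p
    k<p : k < period
    k<p = ℕ.<-trans k<l l<p
    bounds : All (_< period) (0 ∷ k ∷ l ∷ m ∷ [])
    bounds = period-pos ∷ k<p ∷ l<p ∷ m<p ∷ []
    x⇝b : Seg f corners (f x) (iter f k x)
    x⇝b = arc (0 ∷ k ∷ l ∷ m ∷ []) bounds
              (inj₁ z≤n ∷ inj₂ ℕ.≤-refl ∷ inj₂ (ℕ.<⇒≤ k<l) ∷ inj₂ (ℕ.<⇒≤ (ℕ.<-trans k<l l<m)) ∷ [])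
              0<k (ℕ.<⇒≤ k<p)
    b⇝c : Seg f corners (f (iter f k x)) (iter f l x)
    b⇝c = arc (0 ∷ k ∷ l ∷ m ∷ []) bounds
              (inj₁ z≤n ∷ inj₁ ℕ.≤-refl ∷ inj₂ ℕ.≤-refl ∷ inj₂ (ℕ.<⇒≤ l<m) ∷ [])
              k<l (ℕ.<⇒≤ l<p)
    c⇝d : Seg f corners (f (iter f l x)) (iter f m x)
    c⇝d = arc (0 ∷ k ∷ l ∷ m ∷ []) bounds
              (inj₁ z≤n ∷ inj₁ (ℕ.<⇒≤ k<l) ∷ inj₁ ℕ.≤-refl ∷ inj₂ ℕ.≤-refl ∷ [])
              l<m (ℕ.<⇒≤ m<p)
    d⇝x : Seg f corners (f (iter f m x)) x
    d⇝x = subst (Seg f corners _) period-returns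
            (arc (0 ∷ k ∷ l ∷ m ∷ []) bounds
                 (inj₁ z≤n ∷ inj₁ (ℕ.<⇒≤ (ℕ.<-trans k<l l<m)) ∷ inj₁ (ℕ.<⇒≤ l<m) ∷ inj₁ ℕ.≤-refl ∷ [])
                 m<p ℕ.≤-refl)
    forward : ∀ z → z ∈ corners → Reach f z (σ ⟨$⟩ʳ z)
    forward _ (here refl) =
      subst (Reach f x) (sym a↦c) (Reach-trans (Seg→Reach x⇝b) (Seg→Reach b⇝c))
    forward _ (there (here refl)) =
      subst (Reach f _) (sym b↦d) (Reach-trans (Seg→Reach b⇝c) (Seg→Reach c⇝d))
    forward _ (there (there (here refl))) =
      subst (Reach f _) (sym c↦a) (Reach-trans (Seg→Reach c⇝d) (Seg→Reach d⇝x))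
    forward _ (there (there (there (here refl)))) =
      subst (Reach f _) (sym d↦b) (Reach-trans (Seg→Reach d⇝x) (Seg→Reach x⇝b))
    backward : ∀ z → z ∈ corners → ∃[ w ] σ ⟨$⟩ʳ w ≡ z × Reach g z w
    backward _ (here refl)                         = _ , c↦a , Reach-trans (hop a↦c c⇝d) (hop d↦b b⇝c)
    backward _ (there (here refl))                 = _ , d↦b , Reach-trans (hop b↦d d⇝x) (hop a↦c c⇝d)
    backward _ (there (there (here refl)))         = _ , a↦c , Reach-trans (hop c↦a x⇝b) (hop b↦d d⇝x)
    backward _ (there (there (there (here refl)))) = _ , b↦d , Reach-trans (hop d↦b b⇝c) (hop c↦a x⇝b)

module _ {n : ℕ} where

  SameCycle-sym : ∀ {π : Permutation′ n} {i j} → SameCycle π i j → SameCycle π j i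
  SameCycle-sym {π} {i} s = Equivalence.from (SameCycle⇔Reach π)
    (Orbit.return-path π i (Equivalence.to (SameCycle⇔Reach π) s))

  SameCycle-trans : ∀ {π : Permutation′ n} {i j k} → SameCycle π i j → SameCycle π j k → SameCycle π i k
  SameCycle-trans {π} s t = Equivalence.from (SameCycle⇔Reach π)
    (Reach-trans (Equivalence.to (SameCycle⇔Reach π) s) (Equivalence.to (SameCycle⇔Reach π) t))

module _ {A : Set} (a b c : A) where
  private
    ina : a ∈ a ∷ b ∷ c ∷ []
    ina = here refl
    inb : b ∈ a ∷ b ∷ c ∷ []
    inb = there (here refl)
    inc : c ∈ a ∷ b ∷ c ∷ []
    inc = there (there (here refl))

  sort3 : (key : A → ℕ) → key a ≢ key b → key a ≢ key c → key b ≢ key c →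
          ∃[ u ] ∃[ v ] ∃[ w ] All (_∈ a ∷ b ∷ c ∷ []) (u ∷ v ∷ w ∷ []) × key u < key v × key v < key w
  sort3 key a≢b a≢c b≢c
    with ℕ.<-cmp (key a) (key b) | ℕ.<-cmp (key a) (key c) | ℕ.<-cmp (key b) (key c)
  ... | tri≈ _ e _   | _             | _             = contradiction e a≢b
  ... | _            | tri≈ _ e _    | _             = contradiction e a≢c
  ... | _            | _             | tri≈ _ e _    = contradiction e b≢c
  ... | tri< a<b _ _ | tri< _ _ _    | tri< b<c _ _ = a , b , c , (ina ∷ inb ∷ inc ∷ []) , a<b , b<c
  ... | tri< _ _ _   | tri< a<c _ _ | tri> _ _ c<b = a , c , b , (ina ∷ inc ∷ inb ∷ []) , a<c , c<b
  ... | tri< a<b _ _ | tri> _ _ c<a | tri< b<c _ _ = contradiction (ℕ.<-trans c<a a<b) (ℕ.<-asym b<c)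
  ... | tri< a<b _ _ | tri> _ _ c<a | tri> _ _ _   = c , a , b , (inc ∷ ina ∷ inb ∷ []) , c<a , a<b
  ... | tri> _ _ b<a | tri< a<c _ _ | tri< _ _ _   = b , a , c , (inb ∷ ina ∷ inc ∷ []) , b<a , a<c
  ... | tri> _ _ b<a | tri< a<c _ _ | tri> _ _ c<b = contradiction (ℕ.<-trans b<a a<c) (ℕ.<-asym c<b)
  ... | tri> _ _ _   | tri> _ _ c<a | tri< b<c _ _ = b , c , a , (inb ∷ inc ∷ ina ∷ []) , b<c , c<a
  ... | tri> _ _ b<a | tri> _ _ _   | tri> _ _ c<b = c , b , a , (inc ∷ inb ∷ ina ∷ []) , c<b , b<a

record CommonFlip {n : ℕ} (π ρ : Permutation′ n) (Q : List (Fin n)) (y : Fin n) : Set where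
  field
    σ : Permutation′ n
    supported : ∀ z → z ∉ Q → σ ⟨$⟩ʳ z ≡ z
    moves : σ ⟨$⟩ʳ y ≢ y
    keeps-π : SameOrbits (λ z → π ⟨$⟩ʳ (σ ⟨$⟩ʳ z)) (π ⟨$⟩ʳ_)
    keeps-ρ : SameOrbits (λ z → ρ ⟨$⟩ʳ (σ ⟨$⟩ʳ z)) (ρ ⟨$⟩ʳ_)

-- Four distinct points lying on one cycle of π and on one cycle of ρ admit a
-- common flip. Order three of them by their position after y₀ on the π-cycle:
-- y₀, u, v, w. If some pair of u, v, w occurs in the same order on the
-- ρ-cycle, rotating it together with y₀ works; otherwise the ρ-cycle meets
-- them as y₀, w, v, u, and exchanging opposite corners (y₀ v)(u w) works.
module Flip {n : ℕ} (π ρ : Permutation′ n) (y₀ : Fin n) where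
  private
    module V = Orbit π y₀
    module F = Orbit ρ y₀

  record Placed : Set where
    field
      point : Fin n
      vpos fpos : ℕ
      vpos-range : 0 < vpos × vpos < V.period
      fpos-range : 0 < fpos × fpos < F.period
      at-vpos : iter V.f vpos y₀ ≡ point
      at-fpos : iter F.f fpos y₀ ≡ point
  open Placed

  place : ∀ {y} → y₀ ≢ y → Reach V.f y₀ y → Reach F.f y₀ y → Placed
  place {y} y₀≢y on-vertex on-face
    with V.position⁺ (y₀≢y ∘ sym) on-vertex | F.position⁺ (y₀≢y ∘ sym) on-face
  ... | k , k-range , at-k | l , l-range , at-l = record
    { point = y ; vpos = k ; fpos = l ; vpos-range = k-range ; fpos-range = l-range
    ; at-vpos = at-k ; at-fpos = at-l }

  distinct-vpos : ∀ a b → point a ≢ point b → vpos a ≢ vpos b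
  distinct-vpos a b a≢b e =
    a≢b (trans (sym (at-vpos a)) (trans (cong (λ k → iter V.f k y₀) e) (at-vpos b)))

  distinct-fpos : ∀ a b → point a ≢ point b → fpos a ≢ fpos b
  distinct-fpos a b a≢b e =
    a≢b (trans (sym (at-fpos a)) (trans (cong (λ k → iter F.f k y₀) e) (at-fpos b)))

  separated : ∀ a b → vpos a < vpos b → point a ≢ point b
  separated a b a<b e =
    V.no-early-return a<b (proj₂ (vpos-range b)) (trans (at-vpos a) (trans e (sym (at-vpos b))))

  off-base : ∀ a → y₀ ≢ point a
  off-base a e =
    V.no-early-return (proj₁ (vpos-range a)) (proj₂ (vpos-range a)) (trans e (sym (at-vpos a)))

  by-rotation : ∀ {Q} (u v : Placed) → All (_∈ Q) (y₀ ∷ point u ∷ point v ∷ []) →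
                vpos u < vpos v → fpos u < fpos v → CommonFlip π ρ Q y₀
  by-rotation u v inQ vu<vv fu<fv with rotation (off-base u) (separated u v vu<vv) (off-base v)
  ... | σ , rot = record
    { σ = σ
    ; supported = λ z z∉ → IsRotation.fixes rot z (z∉ ∘ lookup inQ)
    ; moves = λ e → off-base u (trans (sym e) (IsRotation.a↦b rot))
    ; keeps-π = V.rotation-preserves (proj₁ (vpos-range u)) vu<vv (proj₂ (vpos-range v))
                  (at-vpos u) (at-vpos v) rot
    ; keeps-ρ = F.rotation-preserves (proj₁ (fpos-range u)) fu<fv (proj₂ (fpos-range v))
                  (at-fpos u) (at-fpos v) rot
    }

  by-crossSwap : ∀ {Q} (u v w : Placed) → All (_∈ Q) (y₀ ∷ point u ∷ point v ∷ point w ∷ []) →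
                 vpos u < vpos v → vpos v < vpos w → fpos w < fpos v → fpos v < fpos u →
                 CommonFlip π ρ Q y₀
  by-crossSwap u v w inQ vu<vv vv<vw fw<fv fv<fu
    with crossSwap (off-base u) (off-base v) (off-base w) (separated u v vu<vv)
                   (separated u w (ℕ.<-trans vu<vv vv<vw)) (separated v w vv<vw)
  ... | σ , cs = record
    { σ = σ
    ; supported = λ z z∉ → IsCrossSwap.fixes cs z (z∉ ∘ lookup inQ)
    ; moves = λ e → off-base v (trans (sym e) (IsCrossSwap.a↦c cs))
    ; keeps-π = V.crossSwap-preserves (proj₁ (vpos-range u)) vu<vv vv<vw (proj₂ (vpos-range w))
                  (at-vpos u) (at-vpos v) (at-vpos w) cs
    ; keeps-ρ = F.crossSwap-preserves (proj₁ (fpos-range w)) fw<fv fv<fu (proj₂ (fpos-range u))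
                  (at-fpos w) (at-fpos v) (at-fpos u) (crossSwap-mirror cs)
    }

  flip : ∀ {y₁ y₂ y₃} → Unique (y₀ ∷ y₁ ∷ y₂ ∷ y₃ ∷ []) →
         All (Reach V.f y₀) (y₁ ∷ y₂ ∷ y₃ ∷ []) → All (Reach F.f y₀) (y₁ ∷ y₂ ∷ y₃ ∷ []) →
         CommonFlip π ρ (y₀ ∷ y₁ ∷ y₂ ∷ y₃ ∷ []) y₀
  flip {y₁} {y₂} {y₃} ((y₀≢y₁ ∷ y₀≢y₂ ∷ y₀≢y₃ ∷ []) ∷ (y₁≢y₂ ∷ y₁≢y₃ ∷ []) ∷ (y₂≢y₃ ∷ []) ∷ [] ∷ [])
       (v₁ ∷ v₂ ∷ v₃ ∷ []) (f₁ ∷ f₂ ∷ f₃ ∷ [])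
    = by-order (sort3 p₁ p₂ p₃ vpos (distinct-vpos p₁ p₂ y₁≢y₂) (distinct-vpos p₁ p₃ y₁≢y₃)
                                    (distinct-vpos p₂ p₃ y₂≢y₃))
    where
    p₁ p₂ p₃ : Placed
    p₁ = place y₀≢y₁ v₁ f₁
    p₂ = place y₀≢y₂ v₂ f₂
    p₃ = place y₀≢y₃ v₃ f₃
    inQ : ∀ {a} → a ∈ p₁ ∷ p₂ ∷ p₃ ∷ [] → point a ∈ y₀ ∷ y₁ ∷ y₂ ∷ y₃ ∷ []
    inQ a∈ = there (∈-map⁺ point a∈)
    by-order : ∃[ u ] ∃[ v ] ∃[ w ] All (_∈ p₁ ∷ p₂ ∷ p₃ ∷ []) (u ∷ v ∷ w ∷ []) ×
                 vpos u < vpos v × vpos v < vpos w → CommonFlip π ρ (y₀ ∷ y₁ ∷ y₂ ∷ y₃ ∷ []) y₀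
    by-order (u , v , w , (u∈ ∷ v∈ ∷ w∈ ∷ []) , vu<vv , vv<vw) with ℕ.<-cmp (fpos u) (fpos v)
    ... | tri< fu<fv _ _ = by-rotation u v (here refl ∷ inQ u∈ ∷ inQ v∈ ∷ []) vu<vv fu<fv
    ... | tri≈ _ e _     = contradiction e (distinct-fpos u v (separated u v vu<vv))
    ... | tri> _ _ fv<fu with ℕ.<-cmp (fpos v) (fpos w)
    ...   | tri< fv<fw _ _ = by-rotation v w (here refl ∷ inQ v∈ ∷ inQ w∈ ∷ []) vv<vw fv<fw
    ...   | tri≈ _ e _     = contradiction e (distinct-fpos v w (separated v w vv<vw))
    ...   | tri> _ _ fw<fv = by-crossSwap u v w (here refl ∷ inQ u∈ ∷ inQ v∈ ∷ inQ w∈ ∷ [])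
                                          vu<vv vv<vw fw<fv fv<fu

-- Splitting Fin (2 * K) into two halves indexed by Fin K: two injective
-- families with disjoint ranges join into an injective family.
module Join {A : Set} (_∼_ : A → A → Set) (∼-sym : ∀ {x y} → x ∼ y → y ∼ x)
            {K : ℕ} (F₀ F₁ : Fin K → A) where

  select : Fin 2 × Fin K → A
  select (0F , a) = F₀ a
  select (1F , a) = F₁ a

  join : Fin (2 * K) → A
  join c = select (remQuot K c)

  join-all : ∀ (P : A → Set) → (∀ a → P (F₀ a)) → (∀ a → P (F₁ a)) → ∀ c → P (join c)
  join-all P P₀ P₁ c = select-all (remQuot K c)
    where
    select-all : ∀ p → P (select p)
    select-all (0F , a) = P₀ a
    select-all (1F , a) = P₁ a

  join-injective : (∀ a b → F₀ a ∼ F₀ b → a ≡ b) → (∀ a b → F₁ a ∼ F₁ b → a ≡ b) →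
                   (∀ a b → ¬ F₀ a ∼ F₁ b) → ∀ c d → join c ∼ join d → c ≡ d
  join-injective injective₀ injective₁ apart c d e = begin
    c                             ≡⟨ Fin.combine-remQuot {2} K c ⟨
    uncurry combine (remQuot K c) ≡⟨ cong (uncurry combine) same-halves ⟩
    uncurry combine (remQuot K d) ≡⟨ Fin.combine-remQuot {2} K d ⟩
    d                             ∎
    where
    select-injective : ∀ p q → select p ∼ select q → p ≡ q
    select-injective (0F , a) (0F , b) e = cong (0F ,_) (injective₀ a b e)
    select-injective (1F , a) (1F , b) e = cong (1F ,_) (injective₁ a b e)
    select-injective (0F , a) (1F , b) e = contradiction e (apart a b)
    select-injective (1F , a) (0F , b) e = contradiction (∼-sym e) (apart b a)
    same-halves : remQuot K c ≡ remQuot K d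
    same-halves = select-injective (remQuot K c) (remQuot K d) e

module Vertices {n : ℕ} (β : Permutation′ n) where

  record Quad (r : Fin n) : Set where
    field
      y₀ y₁ y₂ y₃ : Fin n
      distinct : Unique (y₀ ∷ y₁ ∷ y₂ ∷ y₃ ∷ [])
      at-r : All (SameCycle β r) (y₀ ∷ y₁ ∷ y₂ ∷ y₃ ∷ [])

    points : List (Fin n)
    points = y₀ ∷ y₁ ∷ y₂ ∷ y₃ ∷ []

  Apart : Fin n → Fin n → Set
  Apart r r′ = ∀ z → SameCycle β r z → ¬ SameCycle β r′ z

  private
    hits : Fin n → Fin n → ℕ → Bool
    hits i j k = ⌊ β ^[ k ] i ≟ j ⌋

  inCycle→SameCycle : ∀ {i j} → T (inCycleᵇ β i j) → SameCycle β i j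
  inCycle→SameCycle {i} {j} t with satisfied (any⁻ (hits i j) (upTo n) t)
  ... | k , hit = k , toWitness hit

  -- (the search up to n suffices since the period is at most n)
  SameCycle→inCycle : ∀ {i j} → SameCycle β i j → T (inCycleᵇ β i j)
  SameCycle→inCycle {i} {j} s with Orbit.position β i (Equivalence.to (SameCycle⇔Reach β) s)
  ... | k , k<p , e = any⁺ (hits i j) (lose (∈-upTo⁺ (ℕ.<-≤-trans k<p (Orbit.period≤n β i)))
                                             (fromWitness (trans (pow≡iter β k i) e)))

  IsRep : Fin n → Set
  IsRep r = ∀ j → SameCycle β r j → toℕ r ≤ toℕ j

  isRepᵇ→IsRep : ∀ {r} → T (isRepᵇ β r) → IsRep r
  isRepᵇ→IsRep {r} t j s = ℕ.≤ᵇ⇒≤ (toℕ r) (toℕ j)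
    (implication (lookup (all⁺ _ (allFin n) t) (∈-allFin j)) (SameCycle→inCycle s))
    where
    implication : ∀ {a b} → T (not a ∨ b) → T a → T b
    implication {true} t _ = t

  reps-apart : ∀ {r r′} → IsRep r → IsRep r′ → r ≢ r′ → Apart r r′
  reps-apart {r} {r′} rep rep′ r≢r′ z r-z r′-z = r≢r′ (Fin.toℕ-injective (ℕ.≤-antisym
    (rep r′ (SameCycle-trans r-z (SameCycle-sym r′-z)))
    (rep′ r (SameCycle-trans r′-z (SameCycle-sym r-z)))))

  all-apart : ∀ {L} → All IsRep L → Unique L → AllPairs Apart L
  all-apart []           []          = []
  all-apart (rep ∷ reps) (r≢ ∷ uniq) =
    All.zipWith (λ (rep′ , r≢r′) → reps-apart rep rep′ r≢r′) (reps , r≢) ∷ all-apart reps uniq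

  quad : ∀ {r} xs → Unique xs → All (SameCycle β r) xs → 4 ≤ length xs → Quad r
  quad (a ∷ b ∷ c ∷ d ∷ _) uniq (pa ∷ pb ∷ pc ∷ pd ∷ _) _ =
    record { distinct = UP.take⁺ 4 uniq ; at-r = pa ∷ pb ∷ pc ∷ pd ∷ [] }
  quad []                  _ _ ()
  quad (_ ∷ [])            _ _ (s≤s ())
  quad (_ ∷ _ ∷ [])        _ _ (s≤s (s≤s ()))
  quad (_ ∷ _ ∷ _ ∷ [])    _ _ (s≤s (s≤s (s≤s ())))

  quad-of-degree : ∀ r → 4 ≤ deg β r → Quad r
  quad-of-degree r =
    quad _ (UP.filter⁺ (T? ∘ inCycleᵇ β r) (UP.allFin⁺ n))
           (All.map inCycle→SameCycle (all-filter (T? ∘ inCycleᵇ β r) (allFin n)))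

  big : Fin n → Bool
  big i = isRepᵇ β i ∧ (4 ≤ᵇ deg β i)

  bigVertices : List (Fin n)
  bigVertices = filterᵇ big (allFin n)

  bigVertices-unique : Unique bigVertices
  bigVertices-unique = UP.filter⁺ (T? ∘ big) (UP.allFin⁺ n)

  bigVertices-big : All (T ∘ big) bigVertices
  bigVertices-big = all-filter (T? ∘ big) (allFin n)

  bigVertices-apart : AllPairs Apart bigVertices
  bigVertices-apart =
    all-apart (All.map (isRepᵇ→IsRep ∘ proj₁ ∘ Equivalence.to T-∧) bigVertices-big) bigVertices-unique

  bigVertices-quads : All Quad bigVertices
  bigVertices-quads = All.map
    (λ {r} t → quad-of-degree r (ℕ.≤ᵇ⇒≤ 4 (deg β r) (proj₂ (Equivalence.to T-∧ t))))
    bigVertices-big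

module Embeddings {n : ℕ} (α β : Permutation′ n) where

  open Vertices β using (Quad; Apart)

  Embedding : Permutation′ n → Set
  Embedding = OneFaceEmbedding α β

  -- The face permutation i ↦ α (β′ i) of the map (α, β′).
  faces : Permutation′ n → Permutation′ n
  faces β′ = β′ ∘ₚ α

  -- In a one-face embedding, the four half-edges lie on one vertex and on the
  -- single face, so they admit a common flip.
  flip-at : ∀ {β₀ r} → Embedding β₀ → (q : Quad r) →
            CommonFlip β₀ (faces β₀) (Quad.points q) (Quad.y₀ q)
  flip-at {β₀} {r} (same-vertices , one-face) q =
    Flip.flip β₀ (faces β₀) y₀ distinct (All.map vertex (All.tail at-r)) (face ∷ face ∷ face ∷ [])
    where
    open Quad q
    vertex : ∀ {y} → SameCycle β r y → Reach (β₀ ⟨$⟩ʳ_) y₀ y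
    vertex {y} r-y = Equivalence.to (SameCycle⇔Reach β₀)
      (Equivalence.to (same-vertices y₀ y) (SameCycle-trans (SameCycle-sym (All.head at-r)) r-y))
    face : ∀ {y} → Reach (faces β₀ ⟨$⟩ʳ_) y₀ y
    face {y} = one-face y₀ y

  flip-embedding : ∀ {β₀ Q y} → Embedding β₀ → (φ : CommonFlip β₀ (faces β₀) Q y) →
                   Embedding (CommonFlip.σ φ ∘ₚ β₀)
  flip-embedding {β₀} (same-vertices , one-face) φ =
    (λ i j → ⇔-trans (same-vertices i j)
               (⇔-trans (SameCycle⇔Reach β₀)
                 (⇔-trans (⇔-sym (keeps-π i j)) (⇔-sym (SameCycle⇔Reach (σ ∘ₚ β₀)))))) ,
    (λ i j → Equivalence.from (keeps-ρ i j) (one-face i j))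
    where open CommonFlip φ

  record Family (L : List (Fin n)) (β₀ : Permutation′ n) : Set where
    field
      member : Fin (2 ^ length L) → Permutation′ n
      embedding : ∀ a → Embedding (member a)
      injective : ∀ a b → member a ≈ member b → a ≡ b
      local : ∀ a z → (∀ r → r ∈ L → ¬ SameCycle β r z) → member a ⟨$⟩ʳ z ≡ β₀ ⟨$⟩ʳ z

  -- Induction on L: the family for r ∷ L joins the family for L built on β₀
  -- with the one built on β₀ flipped at r.
  family : ∀ L → AllPairs Apart L → All Quad L → ∀ β₀ → Embedding β₀ → Family L β₀
  family [] _ _ β₀ emb = record
    { member = λ _ → β₀ ; embedding = λ _ → emb
    ; injective = λ { 0F 0F _ → refl } ; local = λ _ _ _ → refl }
  family (r ∷ L) (r-apart ∷ apart) (q ∷ qs) β₀ emb = record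
    { member = join
    ; embedding = join-all Embedding (Family.embedding unflipped) (Family.embedding flipped)
    ; injective = join-injective (Family.injective unflipped) (Family.injective flipped) differ
    ; local = λ c z outside → join-all (λ π → π ⟨$⟩ʳ z ≡ β₀ ⟨$⟩ʳ z)
        (λ a → Family.local unflipped a z (λ r′ → outside r′ ∘ there))
        (λ a → trans (Family.local flipped a z (λ r′ → outside r′ ∘ there))
                     (cong (β₀ ⟨$⟩ʳ_) (fixed-away z (outside r (here refl)))))
        c
    }
    where
    φ : CommonFlip β₀ (faces β₀) (Quad.points q) (Quad.y₀ q)
    φ = flip-at emb q
    open CommonFlip φ
    open Quad q using (y₀; at-r)
    unflipped : Family L β₀
    unflipped = family L apart qs β₀ emb
    flipped : Family L (σ ∘ₚ β₀)
    flipped = family L apart qs (σ ∘ₚ β₀) (flip-embedding emb φ)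
    open Join _≈_ (λ e i → sym (e i)) (Family.member unflipped) (Family.member flipped)
    fixed-away : ∀ z → ¬ SameCycle β r z → σ ⟨$⟩ʳ z ≡ z
    fixed-away z z-away = supported z (z-away ∘ lookup at-r)
    -- y₀ lies at the vertex of r, so only the flip changes β₀ there.
    away : ∀ r′ → r′ ∈ L → ¬ SameCycle β r′ y₀
    away r′ r′∈ = lookup r-apart r′∈ y₀ (All.head at-r)
    differ : ∀ a b → ¬ Family.member unflipped a ≈ Family.member flipped b
    differ a b e = moves (sym (permute-injective β₀ (begin
      β₀ ⟨$⟩ʳ y₀                             ≡⟨ Family.local unflipped a y₀ away ⟨
      Family.member unflipped a ⟨$⟩ʳ y₀       ≡⟨ e y₀ ⟩
      Family.member flipped b ⟨$⟩ʳ y₀         ≡⟨ Family.local flipped b y₀ away ⟩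
      β₀ ⟨$⟩ʳ (σ ⟨$⟩ʳ y₀)                    ∎)))

corollary3p3 : (e : ℕ) (α β : Permutation′ (2 * e)) →
    FPFInvolution α →
    (∃[ β₀ ] OneFaceEmbedding α β β₀) →
    Σ (Fin (2 ^ numDegAtLeast4 β) → Permutation′ (2 * e)) λ f →
      (∀ a → OneFaceEmbedding α β (f a)) ×
      (∀ a b → (∀ i → f a ⟨$⟩ʳ i ≡ f b ⟨$⟩ʳ i) → a ≡ b)
corollary3p3 e α β _ (β₀ , β₀-embedding) = member , embedding , injective
  where
  open Vertices β
  open Embeddings.Family
    (Embeddings.family α β bigVertices bigVertices-apart bigVertices-quads β₀ β₀-embedding)
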